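{- Let $P$ be the set of $\alpha\in\mathbb{F}_2((1/t))$ with $|\alpha|<1$, and let $D\subseteq P$ be the set of irrational $\alpha\in\mathbb{F}_2((1/t))$ whose continued fraction expansion is $\alpha=[0;a_1,a_2,\ldots]$ with $\deg(a_i)=1$ (i.e. $a_i\in\{t,t+1\}$) for all $i\ge1$. Then an element $\alpha\in P$ belongs to $D$ if and only if $$(\alpha\cdot t(t+1))'=\alpha^2+1,$$ where $'$ denotes formal differentiation with respect to $t$.
   Context: $\mathbb{F}_2((1/t))$ is the field of formal Laurent series in $1/t$ over $\mathbb{F}_2$, with absolute value $|\alpha|=|t|^n$ for $\alpha=t^n+\sum_{i<n}c_it^i$ (fixed real $|t|>1$), $|0|=0$. Every irrational element has an infinite continued fraction expansion $[a_0;a_1,a_2,\ldots]$ with $a_i\in\mathbb{F}_2[t]$, $\deg a_i>0$ for $i>0$. Formal differentiation acts termwise: $(\sum c_i t^i)'=\sum i c_i t^{i-1}$. -}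

module Defs where

open import Data.Bool using (Bool; true; false; _∧_; _xor_; if_then_else_)
open import Data.Nat as ℕ using (ℕ; zero; suc)
open import Data.Integer as ℤ using (ℤ; +_; _+_; _-_; _≤ᵇ_; ∣_∣)
open import Data.Product using (Σ; _×_; ∃; _,_)
open import Data.Sum using (_⊎_)
open import Relation.Nullary using (¬_)
open import Relation.Binary.PropositionalEquality using (_≡_)

-- Formal Laurent series in 1/t over F₂ (F₂ = Bool, + = xor, · = ∧).
-- A series is given by an upper exponent bound `top` and raw
-- coefficients; the actual coefficient of t^e is `raw e` if e ≤ top and
-- 0 otherwise.  Thus every value of this type is a genuine element of
-- F₂((1/t)) (support bounded above), and every element arises this way.

record Laurent : Set where
  constructor laurent
  field
    top : ℤ
    raw : ℤ → Bool

open Laurent public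

coeff : Laurent → ℤ → Bool
coeff a e = if e ≤ᵇ top a then raw a e else false

infix 4 _≈_
_≈_ : Laurent → Laurent → Set
a ≈ b = ∀ e → coeff a e ≡ coeff b e

mono : ℤ → Laurent
mono k = laurent k (λ e → (e ≤ᵇ k) ∧ (k ≤ᵇ e))

0L 1L tL : Laurent
0L = laurent (+ 0) (λ _ → false)
1L = mono (+ 0)
tL = mono (+ 1)

infixl 6 _⊕_
infixl 7 _⊗_

_⊕_ : Laurent → Laurent → Laurent
a ⊕ b = laurent (top a ℤ.⊔ top b) (λ e → coeff a e xor coeff b e)

xorSum : ℕ → (ℕ → Bool) → Bool
xorSum zero    f = false
xorSum (suc n) f = f n xor xorSum n f

-- Cauchy product: coefficient of t^e is the sum over i + j = e of
-- a_i b_j; only i with e - top b ≤ i ≤ top a can contribute, so we sum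
-- over i = lo + k, k < ∣ top a - lo + 1 ∣ with lo = e - top b.  (When
-- top a < lo every summand vanishes, so using ∣_∣ there is harmless.)
_⊗_ : Laurent → Laurent → Laurent
a ⊗ b = laurent (top a + top b) (λ e →
  let lo = e - top b in
  xorSum ∣ top a - lo + + 1 ∣
    (λ k → coeff a (lo + + k) ∧ coeff b (e - (lo + + k))))

oddℕ : ℕ → Bool
oddℕ zero    = false
oddℕ (suc n) = if oddℕ n then false else true

oddℤ : ℤ → Bool
oddℤ z = oddℕ ∣ z ∣

-- formal derivative: (Σ c_i t^i)' = Σ i c_i t^(i-1)
deriv : Laurent → Laurent
deriv a = laurent (top a) (λ e → oddℤ (e + + 1) ∧ coeff a (e + + 1))

InP : Laurent → Set
InP α = ∀ (n : ℕ) → coeff α (+ n) ≡ false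

IsPoly : Laurent → Set
IsPoly p = ∀ (n : ℕ) → coeff p (ℤ.-[1+ n ]) ≡ false

Deg1 : Laurent → Set
Deg1 p = coeff p (+ 1) ≡ true × (∀ (n : ℕ) → coeff p (+ (2 ℕ.+ n)) ≡ false)

IsRational : Laurent → Set
IsRational α = Σ Laurent λ p → Σ Laurent λ q →
  IsPoly p × IsPoly q × ¬ (q ≈ 0L) × (q ⊗ α ≈ p)

Irrational : Laurent → Set
Irrational α = ¬ IsRational α

-- `α = [0; a₁, a₂, …]` with complete quotients: the sequence
-- (a (n) = a_{n+1}, β n = [0; a_{n+1}, a_{n+2}, …]) satisfies
-- β 0 = α, |β n| < 1, a n is a polynomial, and β n = 1/(a n + β (n+1)).
-- (Integer/fractional-part decomposition is unique, so this is exactly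
-- the continued-fraction algorithm.)
IsCFExpansion : Laurent → (ℕ → Laurent) → Set
IsCFExpansion α a = Σ (ℕ → Laurent) λ β →
  (β 0 ≈ α) ×
  (∀ n → InP (β n)) ×
  (∀ n → IsPoly (a n)) ×
  (∀ n → β n ⊗ (a n ⊕ β (suc n)) ≈ 1L)

InD : Laurent → Set
InD α = InP α × Irrational α ×
  Σ (ℕ → Laurent) λ a → IsCFExpansion α a × (∀ n → Deg1 (a n))

{-# OPTIONS --safe #-}
-- Write δ(α) = (α t(t+1))′ + α² + 1 for the defect of the equation.  If α = 1/(a + β)
-- with a ∈ {t, t + 1}, then δ(α) (a + β)² = δ(β), because (1/γ)′ = γ′/γ² in
-- characteristic 2, a′ = 1 and a² + a = t(t + 1).  So if α ∈ D, with remainders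
-- β₀ = α, βₘ = 1/(aₘ + βₘ₊₁), then δ(βₘ) = δ(βₘ₊₁) βₘ² and |βₘ| < 1 give
-- |δ(α)| < |t|^(1-2n) for every n; hence δ(α) = 0.
-- Conversely, if δ(α) = 0 and |α| < 1, the constant term of δ(α) forces |α| = |t|⁻¹, so
-- 1/α has integer part t or t + 1 and its fractional part is again a solution in P; this
-- produces the expansion.  Irrationality is the usual descent: from q α = p with
-- polynomials p, q one gets a nonzero denominator of ever smaller degree.

module Submission where

open import Defs

open import Algebra using (CommutativeRing; CommutativeSemiring)
import Algebra.Properties.CommutativeSemigroup as CommSemigroupProperties
import Algebra.Solver.Ring as RingSolver
open import Algebra.Solver.Ring.AlmostCommutativeRing
  using (_-Raw-AlmostCommutative⟶_; fromCommutativeSemiring)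
open import Algebra.Structures using (IsCommutativeSemiring)
open import Algebra.Structures.Biased using (isCommutativeSemiringʳ)
open import Data.Bool as Bool using (Bool; true; false; _∧_; _xor_; not)
open import Data.Bool.Properties
  using ( T-≡; not-distribʳ-xor; xor-comm; xor-assoc; xor-same; xor-identityʳ
        ; ∧-comm; ∧-assoc; ∧-identityʳ; ∧-zeroʳ; ∧-distribˡ-xor; xor-∧-commutativeRing)
open import Data.Bool.Solver using (module xor-∧-Solver)
open import Data.Empty using (⊥-elim)
open import Data.Integer as ℤ using (ℤ; +_; -[1+_]; _+_; _-_; -_; _≤ᵇ_; ∣_∣)
import Data.Integer.Properties as ℤP
open import Data.Integer.Tactic.RingSolver using (solve-∀)
open import Data.Maybe using (Maybe; just; nothing)
open import Data.Nat as ℕ using (ℕ; zero; suc)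
import Data.Nat.Properties as ℕP
open import Data.Product using (Σ; _×_; _,_; proj₁; proj₂)
open import Data.Sum using (_⊎_; inj₁; inj₂)
open import Function.Bundles using (Equivalence; _⇔_; mk⇔)
open import Level using (0ℓ)
open import Relation.Binary.Bundles using (Setoid)
open import Relation.Binary.PropositionalEquality
import Relation.Binary.Reasoning.Setoid as SetoidReasoning
open import Relation.Binary.Structures using (IsEquivalence)
open import Relation.Nullary using (¬_; yes; no)

infix 4 _≼_ _≺_

record _≼_ (i j : ℤ) : Set where
  constructor le
  field
    gap : ℕ
    geq : j ≡ i + + gap
open _≼_ public

_≺_ : ℤ → ℤ → Set
i ≺ j = i + + 1 ≼ j

≼-refl : ∀ {i} → i ≼ i
≼-refl {i} = le 0 (sym (ℤP.+-identityʳ i))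

≼-reflexive : ∀ {i j} → i ≡ j → i ≼ j
≼-reflexive refl = ≼-refl

≼-trans : ∀ {i j k} → i ≼ j → j ≼ k → i ≼ k
≼-trans {i} (le n refl) (le m refl) = le (n ℕ.+ m) (ℤP.+-assoc i (+ n) (+ m))

≼-resp : ∀ {i i′ j j′} → i ≡ i′ → j ≡ j′ → i ≼ j → i′ ≼ j′
≼-resp refl refl p = p

≼-+ : ∀ {i j} k → i ≼ j → i + k ≼ j + k
≼-+ {i} k (le n refl) = le n (swap i (+ n) k)
  where swap : ∀ a b c → a + b + c ≡ a + c + b
        swap = solve-∀

≼-sub : ∀ {i j} k → i ≼ j → k - j ≼ k - i
≼-sub {i} k (le n refl) = le n (shift i (+ n) k)
  where shift : ∀ a b c → c - a ≡ c - (a + b) + b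
        shift = solve-∀

≼-+ℕ : ∀ {i} n → i ≼ i + + n
≼-+ℕ n = le n refl

≺⇒≼ : ∀ {i j} → i ≺ j → i ≼ j
≺⇒≼ p = ≼-trans (≼-+ℕ 1) p

≺-irrefl : ∀ {i} → ¬ (i ≺ i)
≺-irrefl {i} (le n p) = +0≢1+n (begin
  + 0                 ≡⟨ self-cancel i ⟩
  i - i               ≡⟨ cong (_- i) p ⟩
  i + + 1 + + n - i   ≡⟨ cancel i (+ n) ⟩
  + suc n             ∎)
  where
  open ≡-Reasoning
  self-cancel : ∀ a → + 0 ≡ a - a
  self-cancel = solve-∀
  cancel : ∀ a b → a + + 1 + b - a ≡ + 1 + b
  cancel = solve-∀
  +0≢1+n : + 0 ≢ + suc n
  +0≢1+n ()

≼-total : ∀ i j → i ≼ j ⊎ j ≺ i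
≼-total i j with j - i in eq
... | + n = inj₁ (le n (trans (split i j) (cong (λ d → i + d) eq)))
  where split : ∀ a b → b ≡ a + (b - a)
        split = solve-∀
... | -[1+ n ] = inj₂ (le n (trans (split i j) (trans (cong (λ d → j - d) eq) (unfold j (+ n)))))
  where split : ∀ a b → a ≡ b - (b - a)
        split = solve-∀
        unfold : ∀ a b → a - (- (+ 1 + b)) ≡ a + + 1 + b
        unfold = solve-∀

≼⇒≤ : ∀ {i j} → i ≼ j → i ℤ.≤ j
≼⇒≤ {i} (le n refl) = ℤP.i≤i+j i (+ n)

≤⇒≼ : ∀ {i j} → i ℤ.≤ j → i ≼ j
≤⇒≼ {i} {j} i≤j with ≼-total i j
... | inj₁ p = p
... | inj₂ q = ⊥-elim (≺-irrefl (subst (j ≺_) (ℤP.≤-antisym i≤j (≼⇒≤ (≺⇒≼ q))) q))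

≼-antisym : ∀ {i j} → i ≼ j → j ≼ i → i ≡ j
≼-antisym p q = ℤP.≤-antisym (≼⇒≤ p) (≼⇒≤ q)

≼⇒≤ᵇ : ∀ {i j} → i ≼ j → (i ≤ᵇ j) ≡ true
≼⇒≤ᵇ p = Equivalence.to T-≡ (ℤP.≤⇒≤ᵇ (≼⇒≤ p))

≺⇒≰ᵇ : ∀ {i j} → j ≺ i → (i ≤ᵇ j) ≡ false
≺⇒≰ᵇ {i} {j} q with i ≤ᵇ j in eq
... | false = refl
... | true = ⊥-elim (≺-irrefl (subst (j ≺_) (≼-antisym i≼j (≺⇒≼ q)) q))
  where i≼j = ≤⇒≼ (ℤP.≤ᵇ⇒≤ (Equivalence.from T-≡ eq))

≼-∣∣ : ∀ i → i ≼ + ∣ i ∣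
≼-∣∣ (+ n) = ≼-refl
≼-∣∣ -[1+ n ] = le (suc n ℕ.+ suc n) (reflect (+ suc n))
  where reflect : ∀ a → a ≡ - a + (a + a)
        reflect = solve-∀

open CommSemigroupProperties (CommutativeRing.+-commutativeSemigroup xor-∧-commutativeRing)
  using (interchange; x∙yz≈y∙xz)

xorSum-cong : ∀ n {f g : ℕ → Bool} → (∀ k → k ℕ.< n → f k ≡ g k) → xorSum n f ≡ xorSum n g
xorSum-cong zero    f≗g = refl
xorSum-cong (suc n) f≗g =
  cong₂ _xor_ (f≗g n (ℕP.n<1+n n)) (xorSum-cong n (λ k k<n → f≗g k (ℕP.m<n⇒m<1+n k<n)))

xorSum-zero : ∀ n {f : ℕ → Bool} → (∀ k → k ℕ.< n → f k ≡ false) → xorSum n f ≡ false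
xorSum-zero zero    f≗0 = refl
xorSum-zero (suc n) f≗0 =
  cong₂ _xor_ (f≗0 n (ℕP.n<1+n n)) (xorSum-zero n (λ k k<n → f≗0 k (ℕP.m<n⇒m<1+n k<n)))

xorSum-suc-front : ∀ n f → xorSum (suc n) f ≡ f 0 xor xorSum n (λ k → f (suc k))
xorSum-suc-front zero    f = refl
xorSum-suc-front (suc n) f =
  trans (cong (f (suc n) xor_) (xorSum-suc-front n f)) (x∙yz≈y∙xz (f (suc n)) (f 0) _)

xorSum-xor : ∀ n f g → xorSum n (λ k → f k xor g k) ≡ xorSum n f xor xorSum n g
xorSum-xor zero    f g = refl
xorSum-xor (suc n) f g =
  trans (cong ((f n xor g n) xor_) (xorSum-xor n f g)) (interchange (f n) (g n) _ _)

xorSum-∧ˡ : ∀ n b f → b ∧ xorSum n f ≡ xorSum n (λ k → b ∧ f k)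
xorSum-∧ˡ zero    b f = ∧-zeroʳ b
xorSum-∧ˡ (suc n) b f =
  trans (∧-distribˡ-xor b (f n) _) (cong ((b ∧ f n) xor_) (xorSum-∧ˡ n b f))

xorSum-∧ʳ : ∀ n b f → xorSum n f ∧ b ≡ xorSum n (λ k → f k ∧ b)
xorSum-∧ʳ n b f =
  trans (∧-comm _ b) (trans (xorSum-∧ˡ n b f) (xorSum-cong n (λ k _ → ∧-comm b (f k))))

xorSum-swap : ∀ n m (f : ℕ → ℕ → Bool) →
  xorSum n (λ i → xorSum m (f i)) ≡ xorSum m (λ j → xorSum n (λ i → f i j))
xorSum-swap zero    m f = sym (xorSum-zero m (λ _ _ → refl))
xorSum-swap (suc n) m f = trans (cong (xorSum m (f n) xor_) (xorSum-swap n m f))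
  (sym (xorSum-xor m (f n) (λ j → xorSum n (λ i → f i j))))

xorSum-reverse : ∀ n f → xorSum n f ≡ xorSum n (λ k → f (n ℕ.∸ suc k))
xorSum-reverse zero    f = refl
xorSum-reverse (suc n) f = trans (cong (f n xor_) (xorSum-reverse n f))
  (sym (xorSum-suc-front n (λ k → f (suc n ℕ.∸ suc k))))

windowSum : ℤ → ℕ → (ℤ → Bool) → Bool
windowSum L N f = xorSum N (λ k → f (L + + k))

SupportedIn : ℤ → ℕ → (ℤ → Bool) → Set
SupportedIn L N f = (∀ i → i ≺ L → f i ≡ false) × (∀ i → L + + N ≼ i → f i ≡ false)

windowSum-extendʳ : ∀ L N f → (∀ i → L + + N ≼ i → f i ≡ false) →
  ∀ j → windowSum L (j ℕ.+ N) f ≡ windowSum L N f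
windowSum-extendʳ L N f vanish zero    = refl
windowSum-extendʳ L N f vanish (suc j) =
  cong₂ _xor_ (vanish _ (le j (reassoc L (+ j) (+ N)))) (windowSum-extendʳ L N f vanish j)
  where reassoc : ∀ a b c → a + (b + c) ≡ a + c + b
        reassoc = solve-∀

windowSum-extendˡ : ∀ L N f → (∀ i → i ≺ L → f i ≡ false) →
  ∀ j → windowSum (L - + j) (j ℕ.+ N) f ≡ windowSum L N f
windowSum-extendˡ L N f vanish zero    = cong (λ x → windowSum x N f) (ℤP.+-identityʳ L)
windowSum-extendˡ L N f vanish (suc j) =
  trans (xorSum-suc-front (j ℕ.+ N) (λ k → f (L - + suc j + + k)))
  (trans (cong₂ _xor_ (vanish _ (le j (below L (+ j))))
                      (xorSum-cong (j ℕ.+ N) (λ k _ → cong f (shift L (+ j) (+ k)))))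
  (windowSum-extendˡ L N f vanish j))
  where
  below : ∀ a b → a ≡ a - (+ 1 + b) + + 0 + + 1 + b
  below = solve-∀
  shift : ∀ a b c → a - (+ 1 + b) + (+ 1 + c) ≡ a - b + c
  shift = solve-∀

windowSum-enlarge : ∀ L N L′ N′ f → SupportedIn L N f → L′ ≼ L → L + + N ≼ L′ + + N′ →
  windowSum L′ N′ f ≡ windowSum L N f
windowSum-enlarge L N L′ N′ f (vanishˡ , vanishʳ) (le j refl) (le r end≡) =
  trans (cong₂ (λ x y → windowSum x y f) (undo L′ (+ j)) N′≡)
  (trans (windowSum-extendˡ L (r ℕ.+ N) f vanishˡ j) (windowSum-extendʳ L N f vanishʳ r))
  where
  undo : ∀ a b → a ≡ a + b - b
  undo = solve-∀
  undo′ : ∀ a b → b ≡ a + b - a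
  undo′ = solve-∀
  width : ∀ a j n r → a + j + n + r - a ≡ j + (r + n)
  width = solve-∀
  N′≡ : N′ ≡ j ℕ.+ (r ℕ.+ N)
  N′≡ = ℤP.+-injective (begin
    + N′                         ≡⟨ undo′ L′ (+ N′) ⟩
    L′ + + N′ - L′               ≡⟨ cong (_- L′) end≡ ⟩
    L′ + + j + + N + + r - L′    ≡⟨ width L′ (+ j) (+ N) (+ r) ⟩
    + (j ℕ.+ (r ℕ.+ N))          ∎)
    where open ≡-Reasoning

lowerBound : ∀ i j → Σ ℤ λ m → m ≼ i × m ≼ j
lowerBound i j with ≼-total i j
... | inj₁ i≼j = i , ≼-refl , i≼j
... | inj₂ j≺i = j , ≺⇒≼ j≺i , ≼-refl

upperBound : ∀ i j → Σ ℤ λ m → i ≼ m × j ≼ m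
upperBound i j with ≼-total i j
... | inj₁ i≼j = j , i≼j , ≼-refl
... | inj₂ j≺i = i , ≼-refl , ≺⇒≼ j≺i

windowSum-indep : ∀ L N L′ N′ f → SupportedIn L N f → SupportedIn L′ N′ f →
  windowSum L N f ≡ windowSum L′ N′ f
windowSum-indep L N L′ N′ f supp supp′
  with lowerBound L L′ | upperBound (L + + N) (L′ + + N′)
... | lo , lo≼L , lo≼L′ | hi , end≼hi , end′≼hi =
  trans (sym (windowSum-enlarge L N lo (gap lo≼hi) f supp lo≼L (≼-resp refl (geq lo≼hi) end≼hi)))
        (windowSum-enlarge L′ N′ lo (gap lo≼hi) f supp′ lo≼L′ (≼-resp refl (geq lo≼hi) end′≼hi))
  where
  lo≼hi : lo ≼ hi
  lo≼hi = ≼-trans lo≼L (≼-trans (≼-+ℕ N) end≼hi)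

coeff-above-top : ∀ a i → top a + + 1 ≼ i → coeff a i ≡ false
coeff-above-top a i p rewrite ≺⇒≰ᵇ {i} {top a} p = refl

coeff-upto-top : ∀ a i → i ≼ top a → coeff a i ≡ raw a i
coeff-upto-top a i p rewrite ≼⇒≤ᵇ p = refl

record DegBelow (a : Laurent) (A : ℤ) : Set where
  constructor degBelow
  field vanishes : ∀ i → A ≼ i → coeff a i ≡ false
open DegBelow public

degBelow-top : ∀ a → DegBelow a (top a + + 1)
degBelow-top a = degBelow (coeff-above-top a)

degBelow-mono : ∀ {a A A′} → A ≼ A′ → DegBelow a A → DegBelow a A′
degBelow-mono A≼A′ (degBelow deg) = degBelow (λ i A′≼i → deg i (≼-trans A≼A′ A′≼i))

degBelow-resp : ∀ {a b A} → a ≈ b → DegBelow a A → DegBelow b A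
degBelow-resp a≈b (degBelow deg) = degBelow (λ i A≼i → trans (sym (a≈b i)) (deg i A≼i))

inP⇒degBelow0 : ∀ {a} → InP a → DegBelow a (+ 0)
inP⇒degBelow0 inP = degBelow (λ { i (le n refl) → inP n })

coeff-0L : ∀ e → coeff 0L e ≡ false
coeff-0L e with e ≤ᵇ + 0
... | true  = refl
... | false = refl

coeff-⊕ : ∀ a b e → coeff (a ⊕ b) e ≡ coeff a e xor coeff b e
coeff-⊕ a b e with ≼-total e (top a ℤ.⊔ top b)
... | inj₁ p rewrite ≼⇒≤ᵇ p = refl
... | inj₂ q rewrite ≺⇒≰ᵇ {e} {top a ℤ.⊔ top b} q = sym (cong₂ _xor_
  (coeff-above-top a e (≼-trans (≼-+ (+ 1) (≤⇒≼ (ℤP.i≤i⊔j (top a) (top b)))) q))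
  (coeff-above-top b e (≼-trans (≼-+ (+ 1) (≤⇒≼ (ℤP.i≤j⊔i (top a) (top b)))) q)))

coeff-deriv : ∀ a e → coeff (deriv a) e ≡ oddℤ (e + + 1) ∧ coeff a (e + + 1)
coeff-deriv a e with ≼-total e (top a)
... | inj₁ p rewrite ≼⇒≤ᵇ p = refl
... | inj₂ q rewrite ≺⇒≰ᵇ {e} {top a} q = sym (trans
  (cong (oddℤ (e + + 1) ∧_) (coeff-above-top a (e + + 1) (≼-+ (+ 1) (≺⇒≼ {top a} q))))
  (∧-zeroʳ _))

coeff-mono-≢ : ∀ k x → x ≢ k → coeff (mono k) x ≡ false
coeff-mono-≢ k x x≢k with ≼-total x k
... | inj₂ q rewrite ≺⇒≰ᵇ {x} {k} q = refl
... | inj₁ p with ≼-total k x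
...   | inj₁ p′ = ⊥-elim (x≢k (≼-antisym p p′))
...   | inj₂ q′ rewrite ≼⇒≤ᵇ p | ≺⇒≰ᵇ {k} {x} q′ = refl

degBelow-⊕ : ∀ {a b A} → DegBelow a A → DegBelow b A → DegBelow (a ⊕ b) A
degBelow-⊕ {a} {b} (degBelow deg-a) (degBelow deg-b) = degBelow (λ e A≼e →
  trans (coeff-⊕ a b e) (cong₂ _xor_ (deg-a e A≼e) (deg-b e A≼e)))

degBelow-deriv : ∀ {a A} → DegBelow a A → DegBelow (deriv a) (A - + 1)
degBelow-deriv {a} {A} (degBelow deg) = degBelow (λ e p → trans (coeff-deriv a e)
  (trans (cong (oddℤ (e + + 1) ∧_) (deg (e + + 1) (≼-resp (cancel A) refl (≼-+ (+ 1) p))))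
         (∧-zeroʳ _)))
  where cancel : ∀ A → A - + 1 + + 1 ≡ A
        cancel = solve-∀

convTerm : Laurent → Laurent → ℤ → ℤ → Bool
convTerm a b e i = coeff a i ∧ coeff b (e - i)

convTerm-supportedIn : ∀ {a b A B} e L N → DegBelow a A → DegBelow b B →
  L ≼ e - B + + 1 → A ≼ L + + N → SupportedIn L N (convTerm a b e)
convTerm-supportedIn {a} {b} {A} {B} e L N (degBelow deg-a) (degBelow deg-b) L≼ A≼ =
  (λ i i≺L → trans (cong (coeff a i ∧_) (deg-b (e - i) (B≼e-i i i≺L))) (∧-zeroʳ _)) ,
  (λ i end≼i → cong (_∧ coeff b (e - i)) (deg-a i (≼-trans A≼ end≼i)))
  where
  reflectB : ∀ e B → e + + 1 - (e - B + + 1) ≡ B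
  reflectB = solve-∀
  reflecti : ∀ e i → e + + 1 - (i + + 1) ≡ e - i
  reflecti = solve-∀
  B≼e-i : ∀ i → i ≺ L → B ≼ e - i
  B≼e-i i i≺L = ≼-resp (reflectB e B) (reflecti e i) (≼-sub (e + + 1) (≼-trans i≺L L≼))

span : ℤ → ℤ → ℕ
span A L = ∣ A - L ∣

≼-span : ∀ A L → A ≼ L + + span A L
≼-span A L = ≼-resp (cancel A L) (ℤP.+-comm _ L) (≼-+ L (≼-∣∣ (A - L)))
  where cancel : ∀ a b → a - b + b ≡ a
        cancel = solve-∀

coeff-⊗-window : ∀ a b e L N → SupportedIn L N (convTerm a b e) →
  coeff (a ⊗ b) e ≡ windowSum L N (convTerm a b e)
coeff-⊗-window a b e L N supp =
  trans coeff-⊗-definingWindow (windowSum-indep _ _ L N (convTerm a b e) definingWindow supp)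
  where
  Lₑ = e - top b
  Nₑ = ∣ top a - Lₑ + + 1 ∣
  shiftTop : ∀ e t → e - t ≡ e - (t + + 1) + + 1
  shiftTop = solve-∀
  definingWindow : SupportedIn Lₑ Nₑ (convTerm a b e)
  definingWindow = convTerm-supportedIn e Lₑ Nₑ (degBelow-top a) (degBelow-top b)
    (≼-reflexive (shiftTop e (top b)))
    (≼-resp (cancel (top a) Lₑ) (ℤP.+-comm _ Lₑ) (≼-+ Lₑ (≼-∣∣ (top a - Lₑ + + 1))))
    where cancel : ∀ t L → t - L + + 1 + L ≡ t + + 1
          cancel = solve-∀
  emptyWindow : top a + top b ≺ e → SupportedIn Lₑ 0 (convTerm a b e)
  emptyWindow q = convTerm-supportedIn e Lₑ 0 (degBelow-top a) (degBelow-top b)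
    (≼-reflexive (shiftTop e (top b)))
    (≼-resp (cancel (top a) (top b)) (sym (ℤP.+-identityʳ _)) (≼-+ (- top b) q))
    where cancel : ∀ a b → a + b + + 1 - b ≡ a + + 1
          cancel = solve-∀
  coeff-⊗-definingWindow : coeff (a ⊗ b) e ≡ windowSum Lₑ Nₑ (convTerm a b e)
  coeff-⊗-definingWindow with ≼-total e (top a + top b)
  ... | inj₁ p rewrite ≼⇒≤ᵇ p = refl
  ... | inj₂ q rewrite ≺⇒≰ᵇ {e} {top a + top b} q =
    windowSum-indep Lₑ 0 Lₑ Nₑ (convTerm a b e) (emptyWindow q) definingWindow

coeff-⊗-degBelow : ∀ {a b A B} e L N → DegBelow a A → DegBelow b B →
  L ≼ e - B + + 1 → A ≼ L + + N → coeff (a ⊗ b) e ≡ windowSum L N (convTerm a b e)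
coeff-⊗-degBelow {a} {b} e L N deg-a deg-b L≼ A≼ =
  coeff-⊗-window a b e L N (convTerm-supportedIn e L N deg-a deg-b L≼ A≼)

degBelow-⊗ : ∀ {a b A B} → DegBelow a A → DegBelow b B → DegBelow (a ⊗ b) (A + B - + 1)
degBelow-⊗ {a} {b} {A} {B} deg-a deg-b = degBelow (λ e p →
  coeff-⊗-degBelow e (e - B + + 1) 0 deg-a deg-b ≼-refl
    (≼-resp (cancel A B) (shift e B) (≼-+ (- B + + 1) p)))
  where
  cancel : ∀ A B → A + B - + 1 + (- B + + 1) ≡ A
  cancel = solve-∀
  shift : ∀ e B → e + (- B + + 1) ≡ e - B + + 1 + + 0
  shift = solve-∀

coeff-⊗-lead : ∀ {a b A B} → DegBelow a A → DegBelow b B →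
  coeff (a ⊗ b) (A + B - + 2) ≡ coeff a (A - + 1) ∧ coeff b (B - + 1)
coeff-⊗-lead {a} {b} {A} {B} deg-a deg-b =
  trans (coeff-⊗-degBelow (A + B - + 2) (A - + 1) 1 deg-a deg-b
           (≼-reflexive (eq₁ A B)) (≼-reflexive (eq₂ A)))
  (trans (xor-identityʳ _) (cong₂ _∧_ (cong (coeff a) (eq₃ A)) (cong (coeff b) (eq₄ A B))))
  where
  eq₁ : ∀ A B → A - + 1 ≡ A + B - + 2 - B + + 1
  eq₁ = solve-∀
  eq₂ : ∀ A → A ≡ A - + 1 + + 1
  eq₂ = solve-∀
  eq₃ : ∀ A → A - + 1 + + 0 ≡ A - + 1
  eq₃ = solve-∀
  eq₄ : ∀ A B → A + B - + 2 - (A - + 1 + + 0) ≡ B - + 1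
  eq₄ = solve-∀

coeff-⊗ : ∀ {a b A B} e → DegBelow a A → DegBelow b B →
  coeff (a ⊗ b) e ≡ windowSum (e - B + + 1) (span A (e - B + + 1)) (convTerm a b e)
coeff-⊗ {A = A} {B} e deg-a deg-b =
  coeff-⊗-degBelow e L (span A L) deg-a deg-b ≼-refl (≼-span A L)
  where L = e - B + + 1

-- The ring of Laurent series

≈-refl : ∀ {a} → a ≈ a
≈-refl e = refl

≈-sym : ∀ {a b} → a ≈ b → b ≈ a
≈-sym a≈b e = sym (a≈b e)

≈-trans : ∀ {a b c} → a ≈ b → b ≈ c → a ≈ c
≈-trans a≈b b≈c e = trans (a≈b e) (b≈c e)

≈-isEquivalence : IsEquivalence _≈_
≈-isEquivalence = record { refl = ≈-refl ; sym = ≈-sym ; trans = ≈-trans }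

≈-setoid : Setoid 0ℓ 0ℓ
≈-setoid = record { isEquivalence = ≈-isEquivalence }

⊕-cong : ∀ {a a′ b b′} → a ≈ a′ → b ≈ b′ → a ⊕ b ≈ a′ ⊕ b′
⊕-cong {a} {a′} {b} {b′} a≈a′ b≈b′ e =
  trans (coeff-⊕ a b e) (trans (cong₂ _xor_ (a≈a′ e) (b≈b′ e)) (sym (coeff-⊕ a′ b′ e)))

⊕-comm : ∀ a b → a ⊕ b ≈ b ⊕ a
⊕-comm a b e =
  trans (coeff-⊕ a b e) (trans (xor-comm (coeff a e) (coeff b e)) (sym (coeff-⊕ b a e)))

⊕-assoc : ∀ a b c → (a ⊕ b) ⊕ c ≈ a ⊕ (b ⊕ c)
⊕-assoc a b c e = begin
  coeff ((a ⊕ b) ⊕ c) e                    ≡⟨ coeff-⊕ (a ⊕ b) c e ⟩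
  coeff (a ⊕ b) e xor coeff c e            ≡⟨ cong (_xor coeff c e) (coeff-⊕ a b e) ⟩
  (coeff a e xor coeff b e) xor coeff c e  ≡⟨ xor-assoc (coeff a e) (coeff b e) (coeff c e) ⟩
  coeff a e xor (coeff b e xor coeff c e)  ≡⟨ cong (coeff a e xor_) (coeff-⊕ b c e) ⟨
  coeff a e xor coeff (b ⊕ c) e            ≡⟨ coeff-⊕ a (b ⊕ c) e ⟨
  coeff (a ⊕ (b ⊕ c)) e                    ∎
  where open ≡-Reasoning

⊕-identityʳ : ∀ a → a ⊕ 0L ≈ a
⊕-identityʳ a e =
  trans (coeff-⊕ a 0L e) (trans (cong (coeff a e xor_) (coeff-0L e)) (xor-identityʳ (coeff a e)))

⊕-identityˡ : ∀ a → 0L ⊕ a ≈ a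
⊕-identityˡ a = ≈-trans (⊕-comm 0L a) (⊕-identityʳ a)

⊕-self : ∀ a → a ⊕ a ≈ 0L
⊕-self a e = trans (coeff-⊕ a a e) (trans (xor-same (coeff a e)) (sym (coeff-0L e)))

⊗-cong : ∀ {a a′ b b′} → a ≈ a′ → b ≈ b′ → a ⊗ b ≈ a′ ⊗ b′
⊗-cong {a} {a′} {b} {b′} a≈a′ b≈b′ e =
  trans (coeff-⊗-window a b e L N supp)
  (trans (xorSum-cong N (λ k _ → terms≡ (L + + k)))
  (sym (coeff-⊗-window a′ b′ e L N (supportedIn-resp terms≡ supp))))
  where
  L = e - (top b + + 1) + + 1
  N = span (top a + + 1) L
  supp = convTerm-supportedIn e L N (degBelow-top a) (degBelow-top b) ≼-refl (≼-span _ L)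
  terms≡ : ∀ i → convTerm a b e i ≡ convTerm a′ b′ e i
  terms≡ i = cong₂ _∧_ (a≈a′ i) (b≈b′ (e - i))
  supportedIn-resp : ∀ {L N f g} → (∀ i → f i ≡ g i) → SupportedIn L N f → SupportedIn L N g
  supportedIn-resp f≗g (vanishˡ , vanishʳ) =
    (λ i p → trans (sym (f≗g i)) (vanishˡ i p)) , (λ i p → trans (sym (f≗g i)) (vanishʳ i p))

-- Reversing the window turns a_i b_(e-i) into b_j a_(e-j).
⊗-comm : ∀ a b → a ⊗ b ≈ b ⊗ a
⊗-comm a b e =
  trans (coeff-⊗ e deg-a deg-b)
  (trans (xorSum-reverse N _)
  (trans (xorSum-cong N reversed)
  (sym (coeff-⊗-degBelow e L′ N deg-b deg-a L′≼ B≼))))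
  where
  A = top a + + 1
  B = top b + + 1
  deg-a = degBelow-top a
  deg-b = degBelow-top b
  L = e - B + + 1
  N = span A L
  L′ = e - (L + + N) + + 1
  reflectˡ : ∀ e L k d → e - (e - (L + (+ 1 + k + d)) + + 1 + k) ≡ L + d
  reflectˡ = solve-∀
  reflectʳ : ∀ e L k d → e - (L + d) ≡ e - (L + (+ 1 + k + d)) + + 1 + k
  reflectʳ = solve-∀
  reversed : ∀ k → k ℕ.< N → convTerm a b e (L + + (N ℕ.∸ suc k)) ≡ convTerm b a e (L′ + + k)
  reversed k k<N =
    trans (cong₂ (λ u v → coeff a u ∧ coeff b v) i≡ e-i≡) (∧-comm (coeff a (e - (L′ + + k))) _)
    where
    d = N ℕ.∸ suc k
    N≡ : + (suc k ℕ.+ d) ≡ + N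
    N≡ = cong +_ (ℕP.m+[n∸m]≡n k<N)
    i≡ : L + + d ≡ e - (L′ + + k)
    i≡ = trans (sym (reflectˡ e L (+ k) (+ d))) (cong (λ n → e - (e - (L + n) + + 1 + + k)) N≡)
    e-i≡ : e - (L + + d) ≡ L′ + + k
    e-i≡ = trans (reflectʳ e L (+ k) (+ d)) (cong (λ n → e - (L + n) + + 1 + + k) N≡)
  shift : ∀ e x → e + + 1 - x ≡ e - x + + 1
  shift = solve-∀
  L′≼ : L′ ≼ e - A + + 1
  L′≼ = ≼-resp (shift e (L + + N)) (shift e A) (≼-sub (e + + 1) (≼-span A L))
  reflectB : ∀ e B n → B ≡ e - (e - B + + 1 + n) + + 1 + n
  reflectB = solve-∀
  B≼ : B ≼ L′ + + N
  B≼ = ≼-reflexive (reflectB e B (+ N))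

⊗-distribˡ-⊕ : ∀ a b c → a ⊗ (b ⊕ c) ≈ a ⊗ b ⊕ a ⊗ c
⊗-distribˡ-⊕ a b c e = begin
  coeff (a ⊗ (b ⊕ c)) e                          ≡⟨ coeff-⊗ e deg-a (degBelow-⊕ deg-b deg-c) ⟩
  windowSum L N (convTerm a (b ⊕ c) e)           ≡⟨ xorSum-cong N (λ k _ → terms≡ (L + + k)) ⟩
  windowSum L N (λ i → convTerm a b e i xor convTerm a c e i)
                                                 ≡⟨ xorSum-xor N _ _ ⟩
  windowSum L N (convTerm a b e) xor windowSum L N (convTerm a c e)
      ≡⟨ cong₂ _xor_ (coeff-⊗ e deg-a deg-b) (coeff-⊗ e deg-a deg-c) ⟨
  coeff (a ⊗ b) e xor coeff (a ⊗ c) e            ≡⟨ coeff-⊕ (a ⊗ b) (a ⊗ c) e ⟨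
  coeff (a ⊗ b ⊕ a ⊗ c) e                        ∎
  where
  open ≡-Reasoning
  bound = upperBound (top b) (top c)
  B = proj₁ bound + + 1
  deg-a = degBelow-top a
  deg-b : DegBelow b B
  deg-b = degBelow-mono (≼-+ (+ 1) (proj₁ (proj₂ bound))) (degBelow-top b)
  deg-c : DegBelow c B
  deg-c = degBelow-mono (≼-+ (+ 1) (proj₂ (proj₂ bound))) (degBelow-top c)
  L = e - B + + 1
  N = span (top a + + 1) L
  terms≡ : ∀ i → convTerm a (b ⊕ c) e i ≡ convTerm a b e i xor convTerm a c e i
  terms≡ i = trans (cong (coeff a i ∧_) (coeff-⊕ b c (e - i))) (∧-distribˡ-xor (coeff a i) _ _)

⊗-zeroʳ : ∀ a → a ⊗ 0L ≈ 0L
⊗-zeroʳ a e =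
  trans (coeff-⊗-window a 0L e e 0 ((λ i _ → vanish i) , (λ i _ → vanish i))) (sym (coeff-0L e))
  where
  vanish : ∀ i → convTerm a 0L e i ≡ false
  vanish i = trans (cong (coeff a i ∧_) (coeff-0L (e - i))) (∧-zeroʳ _)

⊗-identityʳ : ∀ a → a ⊗ 1L ≈ a
⊗-identityʳ a e = begin
  coeff (a ⊗ 1L) e                               ≡⟨ coeff-⊗-window a 1L e e 1 (vanishˡ , vanishʳ) ⟩
  convTerm a 1L e (e + + 0) xor false            ≡⟨ xor-identityʳ _ ⟩
  coeff a (e + + 0) ∧ coeff 1L (e - (e + + 0))   ≡⟨ cong₂ (λ u v → coeff a u ∧ coeff 1L v)
                                                          (ℤP.+-identityʳ e) (self-cancel e) ⟩
  coeff a e ∧ true                               ≡⟨ ∧-identityʳ _ ⟩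
  coeff a e                                      ∎
  where
  open ≡-Reasoning
  self-cancel : ∀ e → e - (e + + 0) ≡ + 0
  self-cancel = solve-∀
  e≡i : ∀ i → e - i ≡ + 0 → e ≡ i
  e≡i i e-i≡0 = trans (split e i) (trans (cong (λ x → i + x) e-i≡0) (ℤP.+-identityʳ i))
    where split : ∀ e i → e ≡ i + (e - i)
          split = solve-∀
  vanishˡ : ∀ i → i ≺ e → convTerm a 1L e i ≡ false
  vanishˡ i i≺e = trans (cong (coeff a i ∧_) (coeff-mono-≢ (+ 0) (e - i)
    (λ e-i≡0 → ≺-irrefl (subst (i ≺_) (e≡i i e-i≡0) i≺e)))) (∧-zeroʳ _)
  vanishʳ : ∀ i → e + + 1 ≼ i → convTerm a 1L e i ≡ false
  vanishʳ i e≺i = trans (cong (coeff a i ∧_) (coeff-mono-≢ (+ 0) (e - i)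
    (λ e-i≡0 → ≺-irrefl (subst (e ≺_) (sym (e≡i i e-i≡0)) e≺i)))) (∧-zeroʳ _)

-- Both sides are the double sum of a_j b_(k-j) c_(e-k); swap the order of summation.
⊗-assoc : ∀ a b c → (a ⊗ b) ⊗ c ≈ a ⊗ (b ⊗ c)
⊗-assoc a b c e =
  trans (coeff-⊗ e deg-ab deg-c)
  (trans (xorSum-cong Nₖ (λ k _ → trans (cong (_∧ cₖ k) (inner k)) (xorSum-∧ʳ Nⱼ (cₖ k) _)))
  (trans (xorSum-swap Nₖ Nⱼ _)
  (trans (xorSum-cong Nⱼ (λ j _ → outer j))
  (sym (coeff-⊗-degBelow e Lⱼ Nⱼ deg-a deg-bc (≼-reflexive (shift e B C)) (≼-span A Lⱼ))))))
  where
  A = top a + + 1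
  B = top b + + 1
  C = top c + + 1
  deg-a = degBelow-top a
  deg-b = degBelow-top b
  deg-c = degBelow-top c
  deg-ab = degBelow-⊗ deg-a deg-b
  deg-bc = degBelow-⊗ deg-b deg-c
  Lₖ = e - C + + 1
  Nₖ = span (A + B - + 1) Lₖ
  Lⱼ = e - C - B + + 2
  Nⱼ = span A Lⱼ
  cₖ : ℕ → Bool
  cₖ k = coeff c (e - (Lₖ + + k))
  shift : ∀ e B C → e - C - B + + 2 ≡ e - (B + C - + 1) + + 1
  shift = solve-∀
  shiftₖ : ∀ e B C k → e - C - B + + 2 + k ≡ e - C + + 1 + k - B + + 1
  shiftₖ = solve-∀
  inner : ∀ k → coeff (a ⊗ b) (Lₖ + + k) ≡ xorSum Nⱼ (λ j → convTerm a b (Lₖ + + k) (Lⱼ + + j))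
  inner k = coeff-⊗-degBelow (Lₖ + + k) Lⱼ Nⱼ deg-a deg-b
    (≼-resp refl (shiftₖ e B C (+ k)) (≼-+ℕ k)) (≼-span A Lⱼ)
  outer : ∀ j → xorSum Nₖ (λ k → convTerm a b (Lₖ + + k) (Lⱼ + + j) ∧ cₖ k)
             ≡ convTerm a (b ⊗ c) e (Lⱼ + + j)
  outer j with ≼-total A (Lⱼ + + j)
  ... | inj₁ A≼x = trans
    (xorSum-zero Nₖ (λ k _ → cong (λ u → (u ∧ coeff b (Lₖ + + k - x)) ∧ cₖ k) aₓ≡0))
    (sym (cong (_∧ coeff (b ⊗ c) (e - x)) aₓ≡0))
    where
    x = Lⱼ + + j
    aₓ≡0 = vanishes deg-a x A≼x
  ... | inj₂ x≺A = sym (trans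
      (cong (coeff a x ∧_) (coeff-⊗-degBelow (e - x) Lₓ Nₖ deg-b deg-c ≼-refl B≼))
      (trans (xorSum-∧ˡ Nₖ (coeff a x) _)
      (xorSum-cong Nₖ (λ k _ → trans
        (cong₂ (λ u v → coeff a x ∧ (coeff b u ∧ coeff c v)) (eq₁ e C x (+ k)) (eq₂ e C x (+ k)))
        (sym (∧-assoc (coeff a x) (coeff b (Lₖ + + k - x)) (cₖ k)))))))
    where
    x = Lⱼ + + j
    Lₓ = e - x - C + + 1
    eq₁ : ∀ e C x k → e - x - C + + 1 + k ≡ e - C + + 1 + k - x
    eq₁ = solve-∀
    eq₂ : ∀ e C x k → e - x - (e - x - C + + 1 + k) ≡ e - (e - C + + 1 + k)
    eq₂ = solve-∀
    eq₃ : ∀ A B → A + B - + 1 ≡ A + (B - + 1)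
    eq₃ = solve-∀
    eq₄ : ∀ x B → x + + 1 + (B - + 1) - x ≡ B
    eq₄ = solve-∀
    eq₅ : ∀ e C x n → e - C + + 1 + n - x ≡ e - x - C + + 1 + n
    eq₅ = solve-∀
    B≼ : B ≼ Lₓ + + Nₖ
    B≼ = ≼-resp (eq₄ x B) (eq₅ e C x (+ Nₖ)) (≼-+ (- x)
      (≼-trans (≼-+ (B - + 1) x≺A) (≼-resp (eq₃ A B) refl (≼-span (A + B - + 1) Lₖ))))

⊕-congˡ : ∀ a {b b′} → b ≈ b′ → a ⊕ b ≈ a ⊕ b′
⊕-congˡ a b≈b′ = ⊕-cong {a} {a} (≈-refl {a}) b≈b′

⊕-congʳ : ∀ {a a′} b → a ≈ a′ → a ⊕ b ≈ a′ ⊕ b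
⊕-congʳ b a≈a′ = ⊕-cong {b = b} {b} a≈a′ (≈-refl {b})

⊗-congˡ : ∀ a {b b′} → b ≈ b′ → a ⊗ b ≈ a ⊗ b′
⊗-congˡ a b≈b′ = ⊗-cong {a} {a} (≈-refl {a}) b≈b′

⊗-congʳ : ∀ {a a′} b → a ≈ a′ → a ⊗ b ≈ a′ ⊗ b
⊗-congʳ b a≈a′ = ⊗-cong {b = b} {b} a≈a′ (≈-refl {b})

⊗-identityˡ : ∀ a → 1L ⊗ a ≈ a
⊗-identityˡ a = ≈-trans (⊗-comm 1L a) (⊗-identityʳ a)

⊗-zeroˡ : ∀ a → 0L ⊗ a ≈ 0L
⊗-zeroˡ a = ≈-trans (⊗-comm 0L a) (⊗-zeroʳ a)

⊕-⊗-isCommutativeSemiring : IsCommutativeSemiring _≈_ _⊕_ _⊗_ 0L 1L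
⊕-⊗-isCommutativeSemiring = isCommutativeSemiringʳ (record
  { +-isCommutativeMonoid = record
    { isMonoid = record
      { isSemigroup = record
        { isMagma = record { isEquivalence = ≈-isEquivalence ; ∙-cong = ⊕-cong }
        ; assoc = ⊕-assoc }
      ; identity = ⊕-identityˡ , ⊕-identityʳ }
    ; comm = ⊕-comm }
  ; *-isCommutativeMonoid = record
    { isMonoid = record
      { isSemigroup = record
        { isMagma = record { isEquivalence = ≈-isEquivalence ; ∙-cong = ⊗-cong }
        ; assoc = ⊗-assoc }
      ; identity = ⊗-identityˡ , ⊗-identityʳ }
    ; comm = ⊗-comm }
  ; distribˡ = ⊗-distribˡ-⊕
  ; zeroʳ = ⊗-zeroʳ })

⊕-⊗-commutativeSemiring : CommutativeSemiring 0ℓ 0ℓ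
⊕-⊗-commutativeSemiring = record { isCommutativeSemiring = ⊕-⊗-isCommutativeSemiring }

-- Constants are taken from F₂, so the solver also knows that x ⊕ x ≈ 0L.
fromBool : Bool → Laurent
fromBool true  = 1L
fromBool false = 0L

fromBool-morphism : CommutativeRing.rawRing xor-∧-commutativeRing
  -Raw-AlmostCommutative⟶ fromCommutativeSemiring ⊕-⊗-commutativeSemiring
fromBool-morphism = record
  { ⟦_⟧    = fromBool
  ; +-homo = +-homo
  ; *-homo = *-homo
  ; -‿homo = λ _ → ≈-refl
  ; 0-homo = ≈-refl
  ; 1-homo = ≈-refl
  }
  where
  +-homo : ∀ x y → fromBool (x xor y) ≈ fromBool x ⊕ fromBool y
  +-homo true  true  = ≈-sym (⊕-self 1L)
  +-homo true  false = ≈-sym (⊕-identityʳ 1L)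
  +-homo false y     = ≈-sym (⊕-identityˡ (fromBool y))
  *-homo : ∀ x y → fromBool (x ∧ y) ≈ fromBool x ⊗ fromBool y
  *-homo true  y = ≈-sym (⊗-identityˡ (fromBool y))
  *-homo false y = ≈-sym (⊗-zeroˡ (fromBool y))

fromBool-≟ : ∀ x y → Maybe (fromBool x ≈ fromBool y)
fromBool-≟ x y with x Bool.≟ y
... | yes refl = just ≈-refl
... | no _     = nothing

module ⊕-⊗-Solver = RingSolver (CommutativeRing.rawRing xor-∧-commutativeRing)
  (fromCommutativeSemiring ⊕-⊗-commutativeSemiring) fromBool-morphism fromBool-≟
  using (solve; _:=_; _:+_; _:*_; con)

-- Formal differentiation

oddℕ-suc : ∀ n → oddℕ (suc n) ≡ not (oddℕ n)
oddℕ-suc n with oddℕ n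
... | true  = refl
... | false = refl

oddℤ-suc : ∀ z → oddℤ (z + + 1) ≡ not (oddℤ z)
oddℤ-suc (+ n) rewrite ℕP.+-comm n 1 = oddℕ-suc n
oddℤ-suc -[1+ zero ] = refl
oddℤ-suc -[1+ suc m ] with oddℕ (suc m)
... | true  = refl
... | false = refl

oddℤ-+ℕ : ∀ i n → oddℤ (i + + n) ≡ oddℤ i xor oddℕ n
oddℤ-+ℕ i zero = trans (cong oddℤ (ℤP.+-identityʳ i)) (sym (xor-identityʳ (oddℤ i)))
oddℤ-+ℕ i (suc n) = begin
  oddℤ (i + + suc n)             ≡⟨ cong oddℤ (reassoc i (+ n)) ⟩
  oddℤ (i + + n + + 1)           ≡⟨ oddℤ-suc (i + + n) ⟩
  not (oddℤ (i + + n))           ≡⟨ cong not (oddℤ-+ℕ i n) ⟩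
  not (oddℤ i xor oddℕ n)        ≡⟨ not-distribʳ-xor (oddℤ i) (oddℕ n) ⟩
  oddℤ i xor not (oddℕ n)        ≡⟨ cong (oddℤ i xor_) (oddℕ-suc n) ⟨
  oddℤ i xor oddℕ (suc n)        ∎
  where
  open ≡-Reasoning
  reassoc : ∀ i a → i + (+ 1 + a) ≡ i + a + + 1
  reassoc = solve-∀

oddℤ-+ : ∀ i j → oddℤ (i + j) ≡ oddℤ i xor oddℤ j
oddℤ-+ i (+ n)    = oddℤ-+ℕ i n
oddℤ-+ i -[1+ n ] = begin
  oddℤ j                          ≡⟨ xor-cancelʳ (oddℤ j) odd ⟩
  (oddℤ j xor odd) xor odd        ≡⟨ cong (_xor odd) (oddℤ-+ℕ j (suc n)) ⟨
  oddℤ (j + + suc n) xor odd      ≡⟨ cong (λ x → oddℤ x xor odd) (cancel i (+ suc n)) ⟩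
  oddℤ i xor odd                  ∎
  where
  open ≡-Reasoning
  j = i + -[1+ n ]
  odd = oddℕ (suc n)
  xor-cancelʳ : ∀ x y → x ≡ (x xor y) xor y
  xor-cancelʳ = solve 2 (λ x y → x := (x :+ y) :+ y) refl
    where open xor-∧-Solver
  cancel : ∀ i a → i + - a + a ≡ i
  cancel = solve-∀

deriv-cong : ∀ {a b} → a ≈ b → deriv a ≈ deriv b
deriv-cong {a} {b} a≈b e = trans (coeff-deriv a e)
  (trans (cong (oddℤ (e + + 1) ∧_) (a≈b (e + + 1))) (sym (coeff-deriv b e)))

deriv-⊕ : ∀ a b → deriv (a ⊕ b) ≈ deriv a ⊕ deriv b
deriv-⊕ a b e = begin
  coeff (deriv (a ⊕ b)) e                       ≡⟨ coeff-deriv (a ⊕ b) e ⟩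
  odd ∧ coeff (a ⊕ b) e′                        ≡⟨ cong (odd ∧_) (coeff-⊕ a b e′) ⟩
  odd ∧ (coeff a e′ xor coeff b e′)             ≡⟨ ∧-distribˡ-xor odd _ _ ⟩
  (odd ∧ coeff a e′) xor (odd ∧ coeff b e′)     ≡⟨ cong₂ _xor_ (coeff-deriv a e) (coeff-deriv b e) ⟨
  coeff (deriv a) e xor coeff (deriv b) e       ≡⟨ coeff-⊕ (deriv a) (deriv b) e ⟨
  coeff (deriv a ⊕ deriv b) e                   ∎
  where
  open ≡-Reasoning
  e′ = e + + 1
  odd = oddℤ e′

-- Termwise, i + j = e + 1 and the factor e + 1 splits as i + j mod 2.
deriv-⊗ : ∀ a b → deriv (a ⊗ b) ≈ deriv a ⊗ b ⊕ a ⊗ deriv b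
deriv-⊗ a b e =
  trans (coeff-deriv (a ⊗ b) e)
  (trans (cong (oddℤ (e + + 1) ∧_) (coeff-⊗ (e + + 1) deg-a deg-b))
  (trans (xorSum-∧ˡ N (oddℤ (e + + 1)) _)
  (trans (xorSum-cong N (λ k _ → split k))
  (trans (xorSum-xor N _ _)
  (sym (trans (coeff-⊕ (deriv a ⊗ b) (a ⊗ deriv b) e)
    (cong₂ _xor_ (coeff-⊗-degBelow e (L - + 1) N deg-a′ deg-b (≼-reflexive (eq₁ e B)) A-1≼)
                 (coeff-⊗-degBelow e L N deg-a deg-b′ (≼-reflexive (eq₂ e B)) (≼-span A L)))))))))
  where
  A = top a + + 1
  B = top b + + 1
  deg-a = degBelow-top a
  deg-b = degBelow-top b
  deg-a′ = degBelow-deriv deg-a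
  deg-b′ = degBelow-deriv deg-b
  L = e + + 1 - B + + 1
  N = span A L
  eq₁ : ∀ e B → e + + 1 - B + + 1 - + 1 ≡ e - B + + 1
  eq₁ = solve-∀
  eq₂ : ∀ e B → e + + 1 - B + + 1 ≡ e - (B - + 1) + + 1
  eq₂ = solve-∀
  shift : ∀ L n → L + n - + 1 ≡ L - + 1 + n
  shift = solve-∀
  A-1≼ : A - + 1 ≼ L - + 1 + + N
  A-1≼ = ≼-resp refl (shift L (+ N)) (≼-+ (- + 1) (≼-span A L))
  distrib : ∀ p q u v → (p xor q) ∧ (u ∧ v) ≡ ((p ∧ u) ∧ v) xor (u ∧ (q ∧ v))
  distrib = solve 4 (λ p q u v → (p :+ q) :* (u :* v) := ((p :* u) :* v) :+ (u :* (q :* v))) refl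
    where open xor-∧-Solver
  split : ∀ k → oddℤ (e + + 1) ∧ convTerm a b (e + + 1) (L + + k)
            ≡ convTerm (deriv a) b e (L - + 1 + + k) xor convTerm a (deriv b) e (L + + k)
  split k = trans (cong (_∧ convTerm a b (e + + 1) i) odd≡)
    (trans (distrib (oddℤ i) (oddℤ j) (coeff a i) (coeff b j)) (sym (cong₂ _xor_ term₁ term₂)))
    where
    i = L + + k
    j = e + + 1 - i
    i≡ : ∀ L k → L - + 1 + k + + 1 ≡ L + k
    i≡ = solve-∀
    j≡ : ∀ e L k → e - (L - + 1 + k) ≡ e + + 1 - (L + k)
    j≡ = solve-∀
    j≡′ : ∀ e x → e - x + + 1 ≡ e + + 1 - x
    j≡′ = solve-∀
    e+1≡ : ∀ e x → e + + 1 ≡ x + (e + + 1 - x)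
    e+1≡ = solve-∀
    odd≡ : oddℤ (e + + 1) ≡ oddℤ i xor oddℤ j
    odd≡ = trans (cong oddℤ (e+1≡ e i)) (oddℤ-+ i j)
    term₁ : convTerm (deriv a) b e (L - + 1 + + k) ≡ (oddℤ i ∧ coeff a i) ∧ coeff b j
    term₁ = trans (cong (_∧ coeff b (e - (L - + 1 + + k))) (coeff-deriv a (L - + 1 + + k)))
      (cong₂ (λ z w → (oddℤ z ∧ coeff a z) ∧ coeff b w) (i≡ L (+ k)) (j≡ e L (+ k)))
    term₂ : convTerm a (deriv b) e i ≡ coeff a i ∧ (oddℤ j ∧ coeff b j)
    term₂ = trans (cong (coeff a i ∧_) (coeff-deriv b (e - i)))
      (cong (λ w → coeff a i ∧ (oddℤ w ∧ coeff b w)) (j≡′ e i))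

deriv-1 : deriv 1L ≈ 0L
deriv-1 e with e + + 1 ℤ.≟ + 0
... | yes e+1≡0 = trans (coeff-deriv 1L e)
  (trans (cong (λ z → oddℤ z ∧ coeff 1L z) e+1≡0) (sym (coeff-0L e)))
... | no  e+1≢0 = trans (coeff-deriv 1L e)
  (trans (cong (oddℤ (e + + 1) ∧_) (coeff-mono-≢ (+ 0) _ e+1≢0))
  (trans (∧-zeroʳ _) (sym (coeff-0L e))))

deriv-t : deriv tL ≈ 1L
deriv-t e with e ℤ.≟ + 0
... | yes refl = refl
... | no  e≢0  = trans (coeff-deriv tL e)
  (trans (cong (oddℤ (e + + 1) ∧_) (coeff-mono-≢ (+ 1) _ (λ e+1≡1 → e≢0 (e≡0 e+1≡1))))
  (trans (∧-zeroʳ _) (sym (coeff-mono-≢ (+ 0) e e≢0))))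
  where
  pred : ∀ e → e ≡ e + + 1 - + 1
  pred = solve-∀
  e≡0 : e + + 1 ≡ + 1 → e ≡ + 0
  e≡0 e+1≡1 = trans (pred e) (cong (_- + 1) e+1≡1)

-- The defect of the differential equation

T : Laurent
T = tL ⊗ (tL ⊕ 1L)

defect : Laurent → Laurent
defect α = deriv (α ⊗ T) ⊕ (α ⊗ α ⊕ 1L)

⊕≈0L⇒≈ : ∀ {x y} → x ⊕ y ≈ 0L → x ≈ y
⊕≈0L⇒≈ {x} {y} x⊕y≈0 = begin
  x            ≈⟨ solve 2 (λ x y → x := (x :+ y) :+ y) ≈-refl x y ⟩
  (x ⊕ y) ⊕ y  ≈⟨ ⊕-congʳ y x⊕y≈0 ⟩
  0L ⊕ y       ≈⟨ ⊕-identityˡ y ⟩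
  y            ∎
  where open ⊕-⊗-Solver; open SetoidReasoning ≈-setoid

defect≈0L⇔ode : ∀ α → defect α ≈ 0L ⇔ deriv (α ⊗ T) ≈ α ⊗ α ⊕ 1L
defect≈0L⇔ode α = mk⇔ ⊕≈0L⇒≈ (λ ode → ≈-trans (⊕-congʳ (α ⊗ α ⊕ 1L) ode) (⊕-self (α ⊗ α ⊕ 1L)))

deriv-T : deriv T ≈ 1L
deriv-T = begin
  deriv (tL ⊗ (tL ⊕ 1L))                        ≈⟨ deriv-⊗ tL (tL ⊕ 1L) ⟩
  deriv tL ⊗ (tL ⊕ 1L) ⊕ tL ⊗ deriv (tL ⊕ 1L)
    ≈⟨ ⊕-cong (⊗-congʳ (tL ⊕ 1L) deriv-t)
              (⊗-congˡ tL (≈-trans (deriv-⊕ tL 1L) (⊕-cong deriv-t deriv-1))) ⟩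
  1L ⊗ (tL ⊕ 1L) ⊕ tL ⊗ (1L ⊕ 0L)
    ≈⟨ solve 1 (λ t → con true :* (t :+ con true) :+ t :* (con true :+ con false) := con true)
         ≈-refl tL ⟩
  1L ∎
  where open ⊕-⊗-Solver; open SetoidReasoning ≈-setoid

defect-expand : ∀ α → defect α ≈ deriv α ⊗ T ⊕ α ⊕ α ⊗ α ⊕ 1L
defect-expand α = begin
  deriv (α ⊗ T) ⊕ (α ⊗ α ⊕ 1L)
    ≈⟨ ⊕-congʳ (α ⊗ α ⊕ 1L) (deriv-⊗ α T) ⟩
  deriv α ⊗ T ⊕ α ⊗ deriv T ⊕ (α ⊗ α ⊕ 1L)
    ≈⟨ ⊕-congʳ (α ⊗ α ⊕ 1L) (⊕-congˡ (deriv α ⊗ T) (⊗-congˡ α deriv-T)) ⟩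
  deriv α ⊗ T ⊕ α ⊗ 1L ⊕ (α ⊗ α ⊕ 1L)
    ≈⟨ solve 3 (λ α′ T α → α′ :* T :+ α :* con true :+ (α :* α :+ con true)
         := α′ :* T :+ α :+ α :* α :+ con true) ≈-refl (deriv α) T α ⟩
  deriv α ⊗ T ⊕ α ⊕ α ⊗ α ⊕ 1L ∎
  where open ⊕-⊗-Solver; open SetoidReasoning ≈-setoid

defect-cong : ∀ {α β} → α ≈ β → defect α ≈ defect β
defect-cong α≈β = ⊕-cong (deriv-cong (⊗-congʳ T α≈β)) (⊕-congʳ 1L (⊗-cong α≈β α≈β))

Linear : Laurent → Set
Linear a = a ≈ tL ⊎ a ≈ tL ⊕ 1L

linear-deriv : ∀ {a} → Linear a → deriv a ≈ 1L
linear-deriv (inj₁ a≈t)   = ≈-trans (deriv-cong a≈t) deriv-t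
linear-deriv (inj₂ a≈t+1) =
  ≈-trans (deriv-cong a≈t+1)
    (≈-trans (deriv-⊕ tL 1L) (≈-trans (⊕-cong deriv-t deriv-1) (⊕-identityʳ 1L)))

linear-root : ∀ {a} → Linear a → a ⊗ a ⊕ a ≈ T
linear-root (inj₁ a≈t) = ≈-trans (⊕-cong (⊗-cong a≈t a≈t) a≈t)
  (solve 1 (λ t → t :* t :+ t := t :* (t :+ con true)) ≈-refl tL)
  where open ⊕-⊗-Solver
linear-root (inj₂ a≈t+1) = ≈-trans (⊕-cong (⊗-cong a≈t+1 a≈t+1) a≈t+1)
  (solve 1 (λ t → (t :+ con true) :* (t :+ con true) :+ (t :+ con true) := t :* (t :+ con true))
     ≈-refl tL)
  where open ⊕-⊗-Solver

-- In characteristic 2, (1/γ)′ = γ′/γ².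
defect-inverse : ∀ α γ → α ⊗ γ ≈ 1L → defect α ⊗ (γ ⊗ γ) ≈ T ⊗ deriv γ ⊕ γ ⊕ γ ⊗ γ ⊕ 1L
defect-inverse α γ αγ≈1 = begin
  defect α ⊗ (γ ⊗ γ)
    ≈⟨ ⊗-congʳ (γ ⊗ γ) (defect-expand α) ⟩
  (α′ ⊗ T ⊕ α ⊕ α ⊗ α ⊕ 1L) ⊗ (γ ⊗ γ)
    ≈⟨ solve 4 (λ α′ T α γ → (α′ :* T :+ α :+ α :* α :+ con true) :* (γ :* γ)
         := T :* ((α′ :* γ) :* γ) :+ (α :* γ) :* γ :+ (α :* γ) :* (α :* γ) :+ γ :* γ) ≈-refl α′ T α γ ⟩
  T ⊗ ((α′ ⊗ γ) ⊗ γ) ⊕ (α ⊗ γ) ⊗ γ ⊕ (α ⊗ γ) ⊗ (α ⊗ γ) ⊕ γ ⊗ γ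
    ≈⟨ ⊕-congʳ (γ ⊗ γ) (⊕-cong (⊕-cong (⊗-congˡ T α′γγ≈γ′) (⊗-congʳ γ αγ≈1)) (⊗-cong αγ≈1 αγ≈1)) ⟩
  T ⊗ γ′ ⊕ 1L ⊗ γ ⊕ 1L ⊗ 1L ⊕ γ ⊗ γ
    ≈⟨ solve 3 (λ T γ′ γ → T :* γ′ :+ con true :* γ :+ con true :* con true :+ γ :* γ
         := T :* γ′ :+ γ :+ γ :* γ :+ con true) ≈-refl T γ′ γ ⟩
  T ⊗ γ′ ⊕ γ ⊕ γ ⊗ γ ⊕ 1L ∎
  where
  open ⊕-⊗-Solver
  open SetoidReasoning ≈-setoid
  α′ = deriv α
  γ′ = deriv γ
  leibniz : α′ ⊗ γ ⊕ α ⊗ γ′ ≈ 0L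
  leibniz = ≈-trans (≈-sym (deriv-⊗ α γ)) (≈-trans (deriv-cong αγ≈1) deriv-1)
  α′γγ≈γ′ : (α′ ⊗ γ) ⊗ γ ≈ γ′
  α′γγ≈γ′ = begin
    (α′ ⊗ γ) ⊗ γ   ≈⟨ ⊗-congʳ γ (⊕≈0L⇒≈ leibniz) ⟩
    (α ⊗ γ′) ⊗ γ   ≈⟨ solve 3 (λ α γ′ γ → (α :* γ′) :* γ := γ′ :* (α :* γ)) ≈-refl α γ′ γ ⟩
    γ′ ⊗ (α ⊗ γ)   ≈⟨ ⊗-congˡ γ′ αγ≈1 ⟩
    γ′ ⊗ 1L        ≈⟨ ⊗-identityʳ γ′ ⟩
    γ′             ∎

defect-step : ∀ α β a → Linear a → α ⊗ (a ⊕ β) ≈ 1L →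
  defect α ⊗ ((a ⊕ β) ⊗ (a ⊕ β)) ≈ defect β
defect-step α β a linear αγ≈1 = begin
  defect α ⊗ (γ ⊗ γ)
    ≈⟨ defect-inverse α γ αγ≈1 ⟩
  T ⊗ deriv (a ⊕ β) ⊕ γ ⊕ γ ⊗ γ ⊕ 1L
    ≈⟨ ⊕-congʳ 1L (⊕-congʳ (γ ⊗ γ) (⊕-congʳ γ (⊗-congˡ T
         (≈-trans (deriv-⊕ a β) (⊕-congʳ (deriv β) (linear-deriv linear)))))) ⟩
  T ⊗ (1L ⊕ deriv β) ⊕ (a ⊕ β) ⊕ (a ⊕ β) ⊗ (a ⊕ β) ⊕ 1L
    ≈⟨ solve 4 (λ T β′ a β → T :* (con true :+ β′) :+ (a :+ β) :+ (a :+ β) :* (a :+ β) :+ con true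
         := (β′ :* T :+ β :+ β :* β :+ con true) :+ (a :* a :+ a :+ T)) ≈-refl T (deriv β) a β ⟩
  (deriv β ⊗ T ⊕ β ⊕ β ⊗ β ⊕ 1L) ⊕ (a ⊗ a ⊕ a ⊕ T)
    ≈⟨ ⊕-cong (≈-sym (defect-expand β)) (≈-trans (⊕-congʳ T (linear-root linear)) (⊕-self T)) ⟩
  defect β ⊕ 0L
    ≈⟨ ⊕-identityʳ (defect β) ⟩
  defect β ∎
  where
  open ⊕-⊗-Solver
  open SetoidReasoning ≈-setoid
  γ = a ⊕ β

defect-step⁻¹ : ∀ α β a → Linear a → α ⊗ (a ⊕ β) ≈ 1L → defect α ≈ defect β ⊗ (α ⊗ α)
defect-step⁻¹ α β a linear αγ≈1 = begin
  defect α                                 ≈⟨ ⊗-identityʳ (defect α) ⟨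
  defect α ⊗ 1L                            ≈⟨ ⊗-congˡ (defect α) αγαγ≈1 ⟨
  defect α ⊗ ((α ⊗ γ) ⊗ (α ⊗ γ))           ≈⟨ solve 3 (λ d α γ → d :* ((α :* γ) :* (α :* γ))
                                                := (d :* (γ :* γ)) :* (α :* α)) ≈-refl (defect α) α γ ⟩
  (defect α ⊗ (γ ⊗ γ)) ⊗ (α ⊗ α)           ≈⟨ ⊗-congʳ (α ⊗ α) (defect-step α β a linear αγ≈1) ⟩
  defect β ⊗ (α ⊗ α)                       ∎
  where
  open ⊕-⊗-Solver
  open SetoidReasoning ≈-setoid
  γ = a ⊕ β
  αγαγ≈1 : (α ⊗ γ) ⊗ (α ⊗ γ) ≈ 1L
  αγαγ≈1 = ≈-trans (⊗-cong αγ≈1 αγ≈1) (⊗-identityʳ 1L)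

T-degBelow3 : DegBelow T (+ 3)
T-degBelow3 = degBelow-⊗ (degBelow-top tL) (degBelow-top (tL ⊕ 1L))

defect-degBelow1 : ∀ {β} → InP β → DegBelow (defect β) (+ 1)
defect-degBelow1 {β} inP = degBelow-⊕ (degBelow-deriv (degBelow-⊗ deg-β T-degBelow3))
  (degBelow-⊕ (degBelow-mono (≼-+ℕ 2) (degBelow-⊗ deg-β deg-β)) (degBelow-top 1L))
  where deg-β = inP⇒degBelow0 {β} inP

degBelow-unbounded⇒≈0L : ∀ {x} → (∀ n → DegBelow x (+ 1 - + n)) → x ≈ 0L
degBelow-unbounded⇒≈0L deg e = trans (vanishes (deg (suc ∣ e ∣)) e (1-n≼e e)) (sym (coeff-0L e))
  where
  1-n≼e : ∀ e → + 1 - + suc ∣ e ∣ ≼ e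
  1-n≼e (+ m)    = le (m ℕ.+ m) (eq (+ m))
    where eq : ∀ m → m ≡ + 1 - (+ 1 + m) + (m + m)
          eq = solve-∀
  1-n≼e -[1+ m ] = ≼-reflexive (eq (+ m))
    where eq : ∀ m → + 1 - (+ 1 + (+ 1 + m)) ≡ - (+ 1 + m)
          eq = solve-∀

-- Each step multiplies the defect by a square of absolute value < |t|⁻¹, so it must vanish.
cf-linear⇒defect≈0L : ∀ (β a : ℕ → Laurent) → (∀ n → InP (β n)) → (∀ n → Linear (a n)) →
  (∀ n → β n ⊗ (a n ⊕ β (suc n)) ≈ 1L) → defect (β 0) ≈ 0L
cf-linear⇒defect≈0L β a inP linear step = degBelow-unbounded⇒≈0L (λ n → bound n 0)
  where
  bound : ∀ n m → DegBelow (defect (β m)) (+ 1 - + n)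
  bound zero    m = degBelow-mono (≼-+ℕ 0) (defect-degBelow1 {β m} (inP m))
  bound (suc n) m =
    degBelow-resp (≈-sym (defect-step⁻¹ (β m) (β (suc m)) (a m) (linear m) (step m)))
      (degBelow-mono (le 1 (eq (+ n))) (degBelow-⊗ (bound n (suc m)) (degBelow-⊗ deg-β deg-β)))
    where
    deg-β = inP⇒degBelow0 {β m} (inP m)
    eq : ∀ n → + 1 - (+ 1 + n) ≡ + 1 - n + (+ 0 + + 0 - + 1) - + 1 + + 1
    eq = solve-∀

-- Solutions of the differential equation have linear partial quotients

defect≈0L⇒lead : ∀ {β} → InP β → defect β ≈ 0L → coeff β -[1+ 0 ] ≡ true
defect≈0L⇒lead {β} inP defect≈0 = lead-true (coeff β -[1+ 0 ]) (begin
  (coeff β -[1+ 0 ] ∧ true) xor (false xor true)   ≡⟨ coeff-defect0 ⟨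
  coeff (defect β) (+ 0)                           ≡⟨ defect≈0 (+ 0) ⟩
  coeff 0L (+ 0)                                   ≡⟨⟩
  false                                            ∎)
  where
  open ≡-Reasoning
  deg-β = inP⇒degBelow0 {β} inP
  coeff-defect0 : coeff (defect β) (+ 0) ≡ (coeff β -[1+ 0 ] ∧ true) xor (false xor true)
  coeff-defect0 = trans (coeff-⊕ (deriv (β ⊗ T)) (β ⊗ β ⊕ 1L) (+ 0))
    (cong₂ _xor_ (trans (coeff-deriv (β ⊗ T) (+ 0)) (coeff-⊗-lead deg-β T-degBelow3))
                 (trans (coeff-⊕ (β ⊗ β) 1L (+ 0))
                        (cong (_xor true) (vanishes (degBelow-⊗ deg-β deg-β) (+ 0) (≼-+ℕ 1)))))
  lead-true : ∀ x → (x ∧ true) xor (false xor true) ≡ false → x ≡ true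
  lead-true true  _ = refl
  lead-true false ()

-- The reciprocal Σₖ gₖ t^(1-k) of β = Σₘ cₘ t^-(m+1), with c₀ = 1, by solving
-- Σ_{k≤n} c_(n-k) g_k = [n = 0] for gₙ; `table m` memoises g₀ … g_(m-1).
module Reciprocal (β : Laurent) where
  c : ℕ → Bool
  c m = coeff β -[1+ m ]

  solveNext : (ℕ → Bool) → ℕ → Bool
  solveNext g zero    = true
  solveNext g (suc n) = xorSum (suc n) (λ k → c (suc n ℕ.∸ k) ∧ g k)

  table : ℕ → ℕ → Bool
  table zero    k = false
  table (suc m) k with k ℕ.≟ m
  ... | yes _ = solveNext (table m) m
  ... | no  _ = table m k

  g : ℕ → Bool
  g k = solveNext (table k) k

  table-g : ∀ m k → k ℕ.< m → table m k ≡ g k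
  table-g (suc m) k k<1+m with k ℕ.≟ m
  ... | yes refl = refl
  ... | no  k≢m  = table-g m k (ℕP.≤∧≢⇒< (ℕP.≤-pred k<1+m) k≢m)

  g-solveNext : ∀ n → g n ≡ solveNext g n
  g-solveNext zero    = refl
  g-solveNext (suc n) =
    xorSum-cong (suc n) (λ k k<1+n → cong (c (suc n ℕ.∸ k) ∧_) (table-g (suc n) k k<1+n))

  reciprocal : Laurent
  reciprocal = laurent (+ 1) (λ e → g ∣ + 1 - e ∣)

  convolution : c 0 ≡ true → ∀ n → xorSum (suc n) (λ k → c (n ℕ.∸ k) ∧ g k) ≡ coeff 1L (- + n)
  convolution c₀ zero    rewrite c₀ = refl
  convolution c₀ (suc m) = trans
    (cong₂ _xor_ (trans (cong (λ z → c z ∧ g (suc m)) (ℕP.n∸n≡0 m)) (cong (_∧ g (suc m)) c₀))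
                 (sym (g-solveNext (suc m))))
    (xor-same (g (suc m)))

  coeff-⊗-reciprocal : InP β → ∀ n →
    coeff (β ⊗ reciprocal) (- + n) ≡ xorSum (suc n) (λ k → c (n ℕ.∸ k) ∧ g k)
  coeff-⊗-reciprocal inP n =
    trans (coeff-⊗-degBelow (- + n) L (suc n) (inP⇒degBelow0 {β} inP) (degBelow-top reciprocal)
             (≼-reflexive (eq₁ (+ n))) (≼-reflexive (eq₂ (+ n))))
    (xorSum-cong (suc n) term≡)
    where
    L = - + n - + 1
    eq₁ : ∀ n → - n - + 1 ≡ - n - (+ 1 + + 1) + + 1
    eq₁ = solve-∀
    eq₂ : ∀ n → + 0 ≡ - n - + 1 + (+ 1 + n)
    eq₂ = solve-∀
    term≡ : ∀ k → k ℕ.< suc n → convTerm β reciprocal (- + n) (L + + k) ≡ c (n ℕ.∸ k) ∧ g k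
    term≡ k k<1+n = cong₂ _∧_ βᵢ≡ γⱼ≡
      where
      d = n ℕ.∸ k
      n≡ : + (k ℕ.+ d) ≡ + n
      n≡ = cong +_ (ℕP.m+[n∸m]≡n (ℕP.≤-pred k<1+n))
      i≡ : ∀ k d → - (k + d) - + 1 + k ≡ - (+ 1 + d)
      i≡ = solve-∀
      βᵢ≡ : coeff β (L + + k) ≡ c d
      βᵢ≡ = cong (coeff β) (trans (cong (λ z → - z - + 1 + + k) (sym n≡)) (i≡ (+ k) (+ d)))
      j≡ : ∀ n k → - n - (- n - + 1 + k) ≡ + 1 - k
      j≡ = solve-∀
      j≼1 : ∀ k → + 1 ≡ + 1 - k + k
      j≼1 = solve-∀
      1-j≡ : ∀ k → + 1 - (+ 1 - k) ≡ k
      1-j≡ = solve-∀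
      γⱼ≡ : coeff reciprocal (- + n - (L + + k)) ≡ g k
      γⱼ≡ = trans (cong (coeff reciprocal) (j≡ (+ n) (+ k)))
        (trans (coeff-upto-top reciprocal (+ 1 - + k) (le k (j≼1 (+ k))))
               (cong (λ z → g ∣ z ∣) (1-j≡ (+ k))))

  ⊗-reciprocal : c 0 ≡ true → InP β → β ⊗ reciprocal ≈ 1L
  ⊗-reciprocal c₀ inP e with ≼-total (+ 1) e
  ... | inj₁ 1≼e =
    trans (vanishes (degBelow-⊗ (inP⇒degBelow0 {β} inP) (degBelow-top reciprocal)) e 1≼e)
    (sym (coeff-mono-≢ (+ 0) e (λ e≡0 → ≺-irrefl (subst (+ 1 ≼_) e≡0 1≼e))))
  ... | inj₂ (le n 1≡) =
    trans (cong (coeff (β ⊗ reciprocal)) e≡)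
    (trans (coeff-⊗-reciprocal inP n) (trans (convolution c₀ n) (cong (coeff 1L) (sym e≡))))
    where
    neg : ∀ e n → e ≡ e + + 1 + n - + 1 - n
    neg = solve-∀
    1-1≡ : ∀ n → + 1 - + 1 - n ≡ - n
    1-1≡ = solve-∀
    e≡ : e ≡ - + n
    e≡ = trans (neg e (+ n)) (trans (cong (λ z → z - + 1 - + n) (sym 1≡)) (1-1≡ (+ n)))

open Reciprocal using (reciprocal; ⊗-reciprocal)

linear : Bool → Laurent
linear true  = tL ⊕ 1L
linear false = tL

linear-Linear : ∀ b → Linear (linear b)
linear-Linear true  = inj₂ ≈-refl
linear-Linear false = inj₁ ≈-refl

linear-IsPoly : ∀ b → IsPoly (linear b)
linear-IsPoly true  n = refl
linear-IsPoly false n = refl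

linear-Deg1 : ∀ b → Deg1 (linear b)
linear-Deg1 true  = refl , λ n → refl
linear-Deg1 false = refl , λ n → refl

coeff-linear-0 : ∀ b → coeff (linear b) (+ 0) ≡ b
coeff-linear-0 true  = refl
coeff-linear-0 false = refl

coeff-linear-1 : ∀ b → coeff (linear b) (+ 1) ≡ true
coeff-linear-1 true  = refl
coeff-linear-1 false = refl

coeff-linear-2+ : ∀ b n → coeff (linear b) (+ suc (suc n)) ≡ false
coeff-linear-2+ true  n = refl
coeff-linear-2+ false n = refl

isPoly∧deg1⇒≈linear : ∀ {a} → IsPoly a → Deg1 a → a ≈ linear (coeff a (+ 0))
isPoly∧deg1⇒≈linear {a} poly (a₁ , a₂₊) = a≈linear
  where
  a₀ = coeff a (+ 0)
  a≈linear : a ≈ linear a₀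
  a≈linear (+ zero)        = sym (coeff-linear-0 a₀)
  a≈linear (+ suc zero)    = trans a₁ (sym (coeff-linear-1 a₀))
  a≈linear (+ suc (suc n)) = trans (a₂₊ n) (sym (coeff-linear-2+ a₀ n))
  a≈linear -[1+ n ]        = trans (poly n) (sym (linear-IsPoly a₀ n))

linear-resp : ∀ {a b} → a ≈ b → Linear b → Linear a
linear-resp a≈b (inj₁ b≈t)   = inj₁ (≈-trans a≈b b≈t)
linear-resp a≈b (inj₂ b≈t+1) = inj₂ (≈-trans a≈b b≈t+1)

isPoly∧deg1⇒linear : ∀ {a} → IsPoly a → Deg1 a → Linear a
isPoly∧deg1⇒linear {a} poly deg1 =
  linear-resp (isPoly∧deg1⇒≈linear {a} poly deg1) (linear-Linear (coeff a (+ 0)))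

inP-fractionalPart : ∀ {γ} → DegBelow γ (+ 2) → coeff γ (+ 1) ≡ true →
  InP (linear (coeff γ (+ 0)) ⊕ γ)
inP-fractionalPart {γ} (degBelow deg) γ₁ n =
  trans (coeff-⊕ a γ (+ n))
        (trans (cong (_xor coeff γ (+ n)) (same n)) (xor-same (coeff γ (+ n))))
  where
  a = linear (coeff γ (+ 0))
  same : ∀ n → coeff a (+ n) ≡ coeff γ (+ n)
  same zero          = coeff-linear-0 (coeff γ (+ 0))
  same (suc zero)    = trans (coeff-linear-1 (coeff γ (+ 0))) (sym γ₁)
  same (suc (suc n)) =
    trans (coeff-linear-2+ (coeff γ (+ 0)) n) (sym (deg (+ suc (suc n)) (le n refl)))

partialQuotient : Laurent → Laurent
partialQuotient β = linear (coeff (reciprocal β) (+ 0))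

nextRemainder : Laurent → Laurent
nextRemainder β = partialQuotient β ⊕ reciprocal β

inP-nextRemainder : ∀ β → InP (nextRemainder β)
inP-nextRemainder β = inP-fractionalPart {reciprocal β} (degBelow-top (reciprocal β)) refl

cf-step : ∀ β → InP β → defect β ≈ 0L → β ⊗ (partialQuotient β ⊕ nextRemainder β) ≈ 1L
cf-step β inP defect≈0 = ≈-trans
  (⊗-congˡ β (solve 2 (λ a γ → a :+ (a :+ γ) := γ) ≈-refl (partialQuotient β) (reciprocal β)))
  (⊗-reciprocal β (defect≈0L⇒lead {β} inP defect≈0) inP)
  where open ⊕-⊗-Solver

defect-nextRemainder : ∀ β → InP β → defect β ≈ 0L → defect (nextRemainder β) ≈ 0L
defect-nextRemainder β inP defect≈0 = begin
  defect (nextRemainder β)   ≈⟨ defect-step β (nextRemainder β) (partialQuotient β)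
                                  (linear-Linear (coeff (reciprocal β) (+ 0))) (cf-step β inP defect≈0) ⟨
  defect β ⊗ (γ ⊗ γ)         ≈⟨ ⊗-congʳ (γ ⊗ γ) defect≈0 ⟩
  0L ⊗ (γ ⊗ γ)               ≈⟨ ⊗-zeroˡ (γ ⊗ γ) ⟩
  0L                         ∎
  where
  open SetoidReasoning ≈-setoid
  γ = partialQuotient β ⊕ nextRemainder β

remainders : Laurent → ℕ → Laurent
remainders α zero    = α
remainders α (suc n) = nextRemainder (remainders α n)

partialQuotients : Laurent → ℕ → Laurent
partialQuotients α n = partialQuotient (remainders α n)

inP-remainders : ∀ {α} → InP α → ∀ n → InP (remainders α n)
inP-remainders inP zero    = inP
inP-remainders {α} inP (suc n) = inP-nextRemainder (remainders α n)

defect-remainders : ∀ {α} → InP α → defect α ≈ 0L → ∀ n → defect (remainders α n) ≈ 0L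
defect-remainders inP defect≈0 zero    = defect≈0
defect-remainders {α} inP defect≈0 (suc n) =
  defect-nextRemainder (remainders α n) (inP-remainders inP n) (defect-remainders inP defect≈0 n)

-- Infinite continued fractions are irrational

isPoly-⊕ : ∀ p q → IsPoly p → IsPoly q → IsPoly (p ⊕ q)
isPoly-⊕ p q poly-p poly-q m = trans (coeff-⊕ p q -[1+ m ]) (cong₂ _xor_ (poly-p m) (poly-q m))

isPoly-⊗ : ∀ p q → IsPoly p → IsPoly q → IsPoly (p ⊗ q)
isPoly-⊗ p q poly-p poly-q m = coeff-⊗-window p q -[1+ m ] (+ 0) 0 (vanishˡ , vanishʳ)
  where
  neg : ∀ i g → i ≡ i + + 1 + g - + 1 - g
  neg = solve-∀
  neg′ : ∀ g → + 0 - + 1 - g ≡ - (+ 1 + g)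
  neg′ = solve-∀
  vanishˡ : ∀ i → i ≺ + 0 → convTerm p q -[1+ m ] i ≡ false
  vanishˡ i (le g 0≡) = cong (_∧ coeff q (-[1+ m ] - i))
    (trans (cong (coeff p) i≡) (poly-p g))
    where
    i≡ : i ≡ -[1+ g ]
    i≡ = trans (neg i (+ g)) (trans (cong (λ z → z - + 1 - + g) (sym 0≡)) (neg′ (+ g)))
  shift : ∀ m g → - (+ 1 + m) - (+ 0 + + 0 + g) ≡ - (+ 1 + m + g)
  shift = solve-∀
  vanishʳ : ∀ i → + 0 + + 0 ≼ i → convTerm p q -[1+ m ] i ≡ false
  vanishʳ i (le g refl) = trans
    (cong (coeff p i ∧_) (trans (cong (coeff q) (shift (+ m) (+ g))) (poly-q (m ℕ.+ g))))
    (∧-zeroʳ (coeff p i))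

polynomial-degBelow0 : ∀ {q} → IsPoly q → DegBelow q (+ 0) → q ≈ 0L
polynomial-degBelow0 poly-q deg (+ m)    =
  trans (vanishes deg (+ m) (le m refl)) (sym (coeff-0L (+ m)))
polynomial-degBelow0 poly-q deg -[1+ m ] = trans (poly-q m) (sym (coeff-0L -[1+ m ]))

module _ (β a : ℕ → Laurent) (inP : ∀ n → InP (β n)) (poly : ∀ n → IsPoly (a n))
         (step : ∀ n → β n ⊗ (a n ⊕ β (suc n)) ≈ 1L) where

  -- From q βₙ = p we get p βₙ₊₁ = q + p aₙ, and deg p < deg q.
  remainder-irrational : ∀ d n p q → IsPoly p → IsPoly q → ¬ (q ≈ 0L) → DegBelow q (+ d) →
    ¬ (q ⊗ β n ≈ p)
  remainder-irrational zero n p q poly-p poly-q q≉0 deg-q _ =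
    q≉0 (polynomial-degBelow0 poly-q deg-q)
  remainder-irrational (suc d) n p q poly-p poly-q q≉0 deg-q qβ≈p =
    remainder-irrational d (suc n) (q ⊕ p ⊗ a n) p
      (isPoly-⊕ q (p ⊗ a n) poly-q (isPoly-⊗ p (a n) poly-p (poly n))) poly-p p≉0 deg-p pβ′≈
    where
    open ⊕-⊗-Solver
    γ = a n ⊕ β (suc n)
    pγ≈q : p ⊗ γ ≈ q
    pγ≈q = ≈-trans (⊗-congʳ γ (≈-sym qβ≈p))
      (≈-trans (⊗-assoc q (β n) γ) (≈-trans (⊗-congˡ q (step n)) (⊗-identityʳ q)))
    p≉0 : ¬ (p ≈ 0L)
    p≉0 p≈0 = q≉0 (≈-trans (≈-sym pγ≈q) (≈-trans (⊗-congʳ γ p≈0) (⊗-zeroˡ γ)))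
    shift : ∀ d → + 1 + d + + 0 - + 1 ≡ d
    shift = solve-∀
    deg-p : DegBelow p (+ d)
    deg-p = degBelow-resp qβ≈p (degBelow-mono (≼-reflexive (shift (+ d)))
      (degBelow-⊗ deg-q (inP⇒degBelow0 {β n} (inP n))))
    pβ′≈ : p ⊗ β (suc n) ≈ q ⊕ p ⊗ a n
    pβ′≈ = ≈-trans
      (solve 3 (λ p a β′ → p :* β′ := p :* (a :+ β′) :+ p :* a) ≈-refl p (a n) (β (suc n)))
      (⊕-congʳ (p ⊗ a n) pγ≈q)

cf⇒irrational : ∀ α (β a : ℕ → Laurent) → β 0 ≈ α → (∀ n → InP (β n)) → (∀ n → IsPoly (a n)) →
  (∀ n → β n ⊗ (a n ⊕ β (suc n)) ≈ 1L) → Irrational α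
cf⇒irrational α β a β₀≈α inP poly step (p , q , poly-p , poly-q , q≉0 , qα≈p) =
  remainder-irrational β a inP poly step ∣ top q + + 1 ∣ 0 p q poly-p poly-q q≉0
    (degBelow-mono (≼-∣∣ _) (degBelow-top q)) (≈-trans (⊗-congˡ q β₀≈α) qα≈p)

theorem3 : ∀ (α : Laurent) → InP α →
    (InD α ⇔ (deriv (α ⊗ (tL ⊗ (tL ⊕ 1L))) ≈ α ⊗ α ⊕ 1L))
theorem3 α inP = mk⇔ inD⇒ode ode⇒inD
  where
  inD⇒ode : InD α → deriv (α ⊗ T) ≈ α ⊗ α ⊕ 1L
  inD⇒ode (_ , _ , a , (β , β₀≈α , inP-β , poly , step) , deg1) =
    Equivalence.to (defect≈0L⇔ode α) (≈-trans (defect-cong (≈-sym β₀≈α))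
      (cf-linear⇒defect≈0L β a inP-β (λ n → isPoly∧deg1⇒linear {a n} (poly n) (deg1 n)) step))
  ode⇒inD : deriv (α ⊗ T) ≈ α ⊗ α ⊕ 1L → InD α
  ode⇒inD ode =
    inP , cf⇒irrational α β a ≈-refl inP-β poly step , a , (β , ≈-refl , inP-β , poly , step) , deg1
    where
    β = remainders α
    a = partialQuotients α
    inP-β = inP-remainders inP
    defect≈0 = Equivalence.from (defect≈0L⇔ode α) ode
    poly : ∀ n → IsPoly (a n)
    poly n = linear-IsPoly (coeff (reciprocal (β n)) (+ 0))
    step : ∀ n → β n ⊗ (a n ⊕ β (suc n)) ≈ 1L
    step n = cf-step (β n) (inP-β n) (defect-remainders inP defect≈0 n)
    deg1 : ∀ n → Deg1 (a n)
    deg1 n = linear-Deg1 (coeff (reciprocal (β n)) (+ 0))
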